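{- Let $q$ be a prime power and $\ell,L,m$ positive integers such that $\ell\mid m$, $L\mid m$, and $m/\ell$ and $m/L$ are both even. Then $$S_L\subseteq S_\ell \iff q^\ell+1\mid q^L+1 \iff \ell\mid L \text{ with } L/\ell \text{ odd}.$$
   Context: $S_j=\{x^{q^j+1}:x\in\mathbb F_{q^m}^*\}$ for integers $j\ge0$. -}

module Defs where

open import Level using (Level; _⊔_)
open import Data.Nat using (ℕ; _+_; _^_; _≤_)
open import Data.Nat.Primality using (Prime)
open import Data.Fin using (Fin)
open import Data.Product using (Σ; ∃; _×_; _,_)
open import Relation.Nullary using (¬_)
open import Relation.Binary.PropositionalEquality using (_≡_)
open import Algebra.Bundles using (CommutativeRing)
import Algebra.Bundles
import Algebra.Definitions.RawSemiring as RS

IsPrimePower : ℕ → Set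
IsPrimePower q = Σ ℕ λ p → Σ ℕ λ k → Prime p × 1 ≤ k × q ≡ p ^ k

record Field (c ℓ : Level) : Set (Level.suc (c ⊔ ℓ)) where
  field
    commRing : CommutativeRing c ℓ
  open CommutativeRing commRing public
  field
    1≉0     : ¬ (1# ≈ 0#)
    inverse : ∀ x → ¬ (x ≈ 0#) → ∃ λ y → x * y ≈ 1#
  open RS (Algebra.Bundles.Semiring.rawSemiring semiring) public using () renaming (_^_ to _^ᶠ_)

HasSize : ∀ {c ℓ} → Field c ℓ → ℕ → Set (c ⊔ ℓ)
HasSize F N = Σ (Fin N → Carrier) λ f →
    (∀ i j → f i ≈ f j → i ≡ j) × (∀ x → ∃ λ i → f i ≈ x)
  where open Field F using (Carrier; _≈_; 0#; _^ᶠ_)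

S : ∀ {c ℓ} (F : Field c ℓ) (q j : ℕ) → Field.Carrier F → Set (c ⊔ ℓ)
S F q j y = ∃ λ x → ¬ (x ≈ 0#) × (y ≈ x ^ᶠ (q ^ j + 1))
  where open Field F using (Carrier; _≈_; 0#; _^ᶠ_)

module Submission where

-- Since m/ℓ and m/L are even, n = q^ℓ + 1 and k = q^L + 1 both divide N = q^m − 1 = |F*|, because
-- q^{2ℓ} ≡ 1 modulo q^ℓ + 1. If n ∣ k, every k-th power is an n-th power. Conversely write N = a n = b k
-- and g = gcd a b. A k-th power y satisfies y^b = 1 by Fermat (multiplication by a unit permutes F*),
-- and y^a = 1 when it is also an n-th power, so y^g = 1. A monic polynomial has at most as many roots
-- as its degree, so there are at most g such y, each with at most k k-th roots; hence N ≤ g k, which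
-- forces g = b, so b ∣ a and n ∣ k.
-- For the arithmetic equivalence write L = r + 2sℓ with r < 2ℓ: then q^ℓ + 1 ∣ q^L + 1 iff
-- q^ℓ + 1 ∣ q^r + 1, and comparing sizes this happens exactly when r = ℓ.

open import Defs

module Arithmetic where
  open import Data.Nat
  open import Data.Nat.Properties
  open import Data.Nat.Divisibility
  open import Data.Nat.DivMod
  open import Data.Nat.GCD using (gcd; gcd[m,n]∣m; gcd[m,n]∣n)
  open import Data.Nat.Tactic.RingSolver using (solve-∀)
  open import Data.Product using (_×_; _,_; ∃)
  open import Function.Bundles using (_⇔_; mk⇔; Equivalence)
  open import Relation.Nullary using (¬_; contradiction; yes; no)
  open import Relation.Binary.PropositionalEquality
  open ≡-Reasoning

  m^[1+n]∸1≡m*[m^n∸1]+[m∸1] : ∀ m n → m ^ suc n ∸ 1 ≡ m * (m ^ n ∸ 1) + (m ∸ 1)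
  m^[1+n]∸1≡m*[m^n∸1]+[m∸1] zero    n = refl
  m^[1+n]∸1≡m*[m^n∸1]+[m∸1] (suc m) n with suc m ^ n | m^n>0 (suc m) n
  ... | suc p | _ = identity m p
    where
    identity : ∀ a b → b + a * suc b ≡ suc a * b + a
    identity = solve-∀

  ∣m∸1⇒∣m^n∸1 : ∀ {d} m n → d ∣ m ∸ 1 → d ∣ m ^ n ∸ 1
  ∣m∸1⇒∣m^n∸1 {d} m zero    _      = d ∣0
  ∣m∸1⇒∣m^n∸1 {d} m (suc n) d∣m∸1 = subst (d ∣_) (sym (m^[1+n]∸1≡m*[m^n∸1]+[m∸1] m n))
    (∣m∣n⇒∣m+n (∣n⇒∣m*n m (∣m∸1⇒∣m^n∸1 m n d∣m∸1)) d∣m∸1)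

  m+1∣m*m∸1 : ∀ m → m + 1 ∣ m * m ∸ 1
  m+1∣m*m∸1 zero    = divides 0 refl
  m+1∣m*m∸1 (suc m) = divides m (identity m)
    where
    identity : ∀ a → a + a * suc a ≡ a * (suc a + 1)
    identity = solve-∀

  ∣n∸1⇒[∣m*n+1⇔∣m+1] : ∀ {d} m n .{{_ : NonZero n}} → d ∣ n ∸ 1 → (d ∣ m * n + 1 ⇔ d ∣ m + 1)
  ∣n∸1⇒[∣m*n+1⇔∣m+1] {d} m (suc n) d∣n∸1 = mk⇔
    (λ d∣m*n+1 → ∣m+n∣m⇒∣n (subst (d ∣_) (split m n) d∣m*n+1) (∣n⇒∣m*n m d∣n∸1))
    (λ d∣m+1 → subst (d ∣_) (sym (split m n)) (∣m∣n⇒∣m+n (∣n⇒∣m*n m d∣n∸1) d∣m+1))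
    where
    split : ∀ a b → a * suc b + 1 ≡ a * b + (a + 1)
    split = solve-∀

  q^[n*2ℓ]≡[q^ℓ*q^ℓ]^n : ∀ q ℓ n → q ^ (n * (2 * ℓ)) ≡ (q ^ ℓ * q ^ ℓ) ^ n
  q^[n*2ℓ]≡[q^ℓ*q^ℓ]^n q ℓ n = begin
    q ^ (n * (2 * ℓ))   ≡⟨ cong (q ^_) (*-comm n (2 * ℓ)) ⟩
    q ^ (2 * ℓ * n)     ≡⟨ ^-*-assoc q (2 * ℓ) n ⟨
    (q ^ (2 * ℓ)) ^ n   ≡⟨ cong (λ e → (q ^ e) ^ n) (cong (ℓ +_) (+-identityʳ ℓ)) ⟩
    (q ^ (ℓ + ℓ)) ^ n   ≡⟨ cong (_^ n) (^-distribˡ-+-* q ℓ ℓ) ⟩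
    (q ^ ℓ * q ^ ℓ) ^ n ∎

  q^ℓ+1∣q^[n*2ℓ]∸1 : ∀ q ℓ n → q ^ ℓ + 1 ∣ q ^ (n * (2 * ℓ)) ∸ 1
  q^ℓ+1∣q^[n*2ℓ]∸1 q ℓ n = subst (λ e → q ^ ℓ + 1 ∣ e ∸ 1) (sym (q^[n*2ℓ]≡[q^ℓ*q^ℓ]^n q ℓ n))
    (∣m∸1⇒∣m^n∸1 (q ^ ℓ * q ^ ℓ) n (m+1∣m*m∸1 (q ^ ℓ)))

  q^ℓ+1∣q^[r+n*2ℓ]+1⇔q^ℓ+1∣q^r+1 : ∀ q .{{_ : NonZero q}} ℓ r n →
    (q ^ ℓ + 1 ∣ q ^ (r + n * (2 * ℓ)) + 1 ⇔ q ^ ℓ + 1 ∣ q ^ r + 1)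
  q^ℓ+1∣q^[r+n*2ℓ]+1⇔q^ℓ+1∣q^r+1 q ℓ r n =
    subst (λ e → q ^ ℓ + 1 ∣ e + 1 ⇔ q ^ ℓ + 1 ∣ q ^ r + 1) (sym (^-distribˡ-+-* q r (n * (2 * ℓ))))
      (∣n∸1⇒[∣m*n+1⇔∣m+1] (q ^ r) (q ^ (n * (2 * ℓ))) {{m^n≢0 q (n * (2 * ℓ))}} (q^ℓ+1∣q^[n*2ℓ]∸1 q ℓ n))

  q^ℓ+1∣q^m∸1 : ∀ q ℓ m .{{_ : NonZero ℓ}} → ℓ ∣ m → 2 ∣ m / ℓ → q ^ ℓ + 1 ∣ q ^ m ∸ 1
  q^ℓ+1∣q^m∸1 q ℓ .(t * ℓ) (divides t refl) 2∣m/ℓ with subst (2 ∣_) (m*n/n≡m t ℓ) 2∣m/ℓ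
  ... | divides s refl = subst (λ e → q ^ ℓ + 1 ∣ q ^ e ∸ 1) (sym (*-assoc s 2 ℓ)) (q^ℓ+1∣q^[n*2ℓ]∸1 q ℓ s)

  n+1≢0 : ∀ n → NonZero (n + 1)
  n+1≢0 n = >-nonZero (m≤n+m 1 n)

  ∣∧<⇒≡0 : ∀ {d m} → d ∣ m → m < d → m ≡ 0
  ∣∧<⇒≡0 {m = zero}  _   _   = refl
  ∣∧<⇒≡0 {m = suc _} d∣m m<d = contradiction d∣m (>⇒∤ m<d)

  q^ℓ+1∤q^r+1 : ∀ q ℓ r → 1 < q → r < ℓ → ¬ (q ^ ℓ + 1 ∣ q ^ r + 1)
  q^ℓ+1∤q^r+1 q ℓ r 1<q r<ℓ = >⇒∤ {{n+1≢0 (q ^ r)}} (+-monoˡ-< 1 (^-monoʳ-< q 1<q r<ℓ))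

  q^ℓ+1∣q^[ℓ+r]+1⇒r≡0 : ∀ q ℓ r → 1 < q → r < ℓ → q ^ ℓ + 1 ∣ q ^ (ℓ + r) + 1 → r ≡ 0
  q^ℓ+1∣q^[ℓ+r]+1⇒r≡0 q@(suc _) ℓ r 1<q r<ℓ d∣ = q^r≤1⇒r≡0 r (m∸n≡0⇒m≤n (∣∧<⇒≡0 d∣q^r∸1 q^r∸1<d))
    where
    x = q ^ ℓ
    u = q ^ r
    a*[b+1]≡b*a+1+[a∸1] : ∀ a b .{{_ : NonZero a}} → a * (b + 1) ≡ (b * a + 1) + (a ∸ 1)
    a*[b+1]≡b*a+1+[a∸1] (suc a) b = identity a b
      where
      identity : ∀ a b → suc a * (b + 1) ≡ (b * suc a + 1) + a
      identity = solve-∀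
    -- q^ℓ + 1 divides q^r (q^ℓ + 1) − (q^{ℓ+r} + 1) = q^r − 1, which is smaller than q^ℓ + 1.
    split : u * (x + 1) ≡ (q ^ (ℓ + r) + 1) + (u ∸ 1)
    split = begin
      u * (x + 1)                 ≡⟨ a*[b+1]≡b*a+1+[a∸1] u x {{m^n≢0 q r}} ⟩
      x * u + 1 + (u ∸ 1)         ≡⟨ cong (λ e → e + 1 + (u ∸ 1)) (^-distribˡ-+-* q ℓ r) ⟨
      q ^ (ℓ + r) + 1 + (u ∸ 1)   ∎
    d∣q^r∸1 : x + 1 ∣ u ∸ 1
    d∣q^r∸1 = ∣m+n∣m⇒∣n (subst (x + 1 ∣_) split (n∣m*n u)) d∣
    q^r∸1<d : u ∸ 1 < x + 1
    q^r∸1<d = ≤-<-trans (m∸n≤m u 1) (<-≤-trans (^-monoʳ-< q 1<q r<ℓ) (m≤m+n x 1))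
    q^r≤1⇒r≡0 : ∀ r → q ^ r ≤ 1 → r ≡ 0
    q^r≤1⇒r≡0 zero    _    = refl
    q^r≤1⇒r≡0 (suc r) q^r≤1 = contradiction q^r≤1 (<⇒≱ (^-monoʳ-< q 1<q (z<s {r})))

  q^ℓ+1∣q^n+1⇒n≡ℓ : ∀ q ℓ n → 1 < q → n < 2 * ℓ → q ^ ℓ + 1 ∣ q ^ n + 1 → n ≡ ℓ
  q^ℓ+1∣q^n+1⇒n≡ℓ q ℓ n 1<q n<2ℓ d∣ with n <? ℓ
  ... | yes n<ℓ = contradiction d∣ (q^ℓ+1∤q^r+1 q ℓ n 1<q n<ℓ)
  ... | no  n≮ℓ with m≤n⇒∃[o]m+o≡n (≮⇒≥ n≮ℓ)
  ...   | r , refl = trans (cong (ℓ +_) r≡0) (+-identityʳ ℓ)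
    where
    r<ℓ : r < ℓ
    r<ℓ = +-cancelˡ-< ℓ r ℓ (subst (ℓ + r <_) (cong (ℓ +_) (+-identityʳ ℓ)) n<2ℓ)
    r≡0 : r ≡ 0
    r≡0 = q^ℓ+1∣q^[ℓ+r]+1⇒r≡0 q ℓ r 1<q r<ℓ d∣

  ¬2∣1+2*n : ∀ n → ¬ 2 ∣ 1 + 2 * n
  ¬2∣1+2*n n (divides k eq) = even≢odd k n (trans (*-comm 2 k) (sym eq))

  ¬2∣⇒odd : ∀ n → ¬ 2 ∣ n → ∃ λ s → n ≡ 1 + 2 * s
  ¬2∣⇒odd zero          2∤n = contradiction (2 ∣0) 2∤n
  ¬2∣⇒odd (suc zero)    _   = 0 , refl
  ¬2∣⇒odd (suc (suc n)) 2∤n with ¬2∣⇒odd n (λ 2∣n → 2∤n (∣m∣n⇒∣m+n ∣-refl 2∣n))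
  ... | s , refl = suc s , cong (2 +_) (sym (+-suc s (s + 0)))

  [1+2*s]*ℓ≡ℓ+s*[2*ℓ] : ∀ s ℓ → (1 + 2 * s) * ℓ ≡ ℓ + s * (2 * ℓ)
  [1+2*s]*ℓ≡ℓ+s*[2*ℓ] = solve-∀

  q^ℓ+1∣q^L+1⇔ℓ∣L∧odd : ∀ q ℓ L .{{_ : NonZero ℓ}} → 1 < q →
    (q ^ ℓ + 1 ∣ q ^ L + 1 ⇔ (ℓ ∣ L × ¬ 2 ∣ L / ℓ))
  q^ℓ+1∣q^L+1⇔ℓ∣L∧odd q@(suc _) ℓ L 1<q = mk⇔ to from
    where
    instance
      2ℓ≢0 : NonZero (2 * ℓ)
      2ℓ≢0 = m*n≢0 2 ℓ
    reduce : ∀ r s → q ^ ℓ + 1 ∣ q ^ (r + s * (2 * ℓ)) + 1 ⇔ q ^ ℓ + 1 ∣ q ^ r + 1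
    reduce = q^ℓ+1∣q^[r+n*2ℓ]+1⇔q^ℓ+1∣q^r+1 q ℓ
    to : q ^ ℓ + 1 ∣ q ^ L + 1 → ℓ ∣ L × ¬ 2 ∣ L / ℓ
    to d∣ = divides (1 + 2 * s) L≡ , subst (λ t → ¬ 2 ∣ t) (sym L/ℓ≡) (¬2∣1+2*n s)
      where
      s = L / (2 * ℓ)
      r = L % (2 * ℓ)
      L≡r+s*2ℓ : L ≡ r + s * (2 * ℓ)
      L≡r+s*2ℓ = m≡m%n+[m/n]*n L (2 * ℓ)
      r≡ℓ : r ≡ ℓ
      r≡ℓ = q^ℓ+1∣q^n+1⇒n≡ℓ q ℓ r 1<q (m%n<n L (2 * ℓ))
        (Equivalence.to (reduce r s) (subst (λ e → q ^ ℓ + 1 ∣ q ^ e + 1) L≡r+s*2ℓ d∣))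
      L≡ : L ≡ (1 + 2 * s) * ℓ
      L≡ = trans L≡r+s*2ℓ (trans (cong (_+ s * (2 * ℓ)) r≡ℓ) (sym ([1+2*s]*ℓ≡ℓ+s*[2*ℓ] s ℓ)))
      L/ℓ≡ : L / ℓ ≡ 1 + 2 * s
      L/ℓ≡ = trans (cong (_/ ℓ) L≡) (m*n/n≡m (1 + 2 * s) ℓ)
    from : ℓ ∣ L × ¬ 2 ∣ L / ℓ → q ^ ℓ + 1 ∣ q ^ L + 1
    from (divides t refl , 2∤L/ℓ) with ¬2∣⇒odd t (subst (λ e → ¬ 2 ∣ e) (m*n/n≡m t ℓ) 2∤L/ℓ)
    ... | s , refl = subst (λ e → q ^ ℓ + 1 ∣ q ^ e + 1) (sym ([1+2*s]*ℓ≡ℓ+s*[2*ℓ] s ℓ))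
      (Equivalence.from (reduce ℓ s) ∣-refl)

  cofactors⇒∣ : ∀ {N a b n k} .{{_ : NonZero N}} → N ≡ a * n → N ≡ b * k → N ≤ gcd a b * k → n ∣ k
  cofactors⇒∣ {N} {a} {b} {n} {k} N≡a*n N≡b*k N≤g*k = divides j (*-cancelˡ-≡ k (j * n) b (begin
      b * k       ≡⟨ N≡b*k ⟨
      N           ≡⟨ N≡a*n ⟩
      a * n       ≡⟨ cong (_* n) a≡j*b ⟩
      j * b * n   ≡⟨ cong (_* n) (*-comm j b) ⟩
      b * j * n   ≡⟨ *-assoc b j n ⟩
      b * (j * n) ∎))
    where
    instance
      b*k≢0 : NonZero (b * k)
      b*k≢0 = subst NonZero N≡b*k (>-nonZero (>-nonZero⁻¹ N))
      b≢0 : NonZero b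
      b≢0 = m*n≢0⇒m≢0 b
      k≢0 : NonZero k
      k≢0 = m*n≢0⇒n≢0 b
    gcd≡b : gcd a b ≡ b
    gcd≡b = ≤-antisym (∣⇒≤ (gcd[m,n]∣n a b)) (*-cancelʳ-≤ b (gcd a b) k (subst (_≤ gcd a b * k) N≡b*k N≤g*k))
    open _∣_ (subst (_∣ a) gcd≡b (gcd[m,n]∣m a b)) renaming (quotient to j; equality to a≡j*b)

module ListCounting where
  open import Data.Bool using (true; false)
  open import Data.List using ([]; _∷_; _++_; length; filter)
  open import Data.List.Relation.Unary.All as All using (All; []; _∷_)
  open import Data.List.Relation.Unary.All.Properties using (all-filter) renaming (filter⁺ to All-filter⁺)
  open import Data.List.Relation.Unary.Any as Any using (here; there)
  open import Data.List.Relation.Unary.AllPairs using ([]; _∷_)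
  open import Data.Nat using (ℕ; suc; z≤n; _≤_; _+_; _*_)
  open import Data.Nat.Properties using (+-suc; +-mono-≤)
  open import Data.Product using (_,_; ∃)
  open import Relation.Binary.Bundles using (Setoid)
  import Relation.Binary.Definitions as Binary
  open import Relation.Binary.PropositionalEquality as ≡ using (_≡_)
  open import Relation.Nullary using (does; contradiction)
  open import Relation.Unary using (Pred; Decidable)
  open import Relation.Unary.Properties using (∁?)

  length-filter+length-filter-∁ : ∀ {a p} {A : Set a} {P : Pred A p} (P? : Decidable P) xs →
    length (filter P? xs) + length (filter (∁? P?) xs) ≡ length xs
  length-filter+length-filter-∁ P? []       = ≡.refl
  length-filter+length-filter-∁ P? (x ∷ xs) with does (P? x)
  ... | true  = ≡.cong suc (length-filter+length-filter-∁ P? xs)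
  ... | false = ≡.trans (+-suc _ _) (≡.cong suc (length-filter+length-filter-∁ P? xs))

  module UniqueLists {a ℓ} (S : Setoid a ℓ) where
    open Setoid S
    open import Data.List.Membership.Setoid S using (_∈_)
    open import Data.List.Membership.Setoid.Properties using (∈-∃++; ∈-resp-≈; All[≉]⇒∉)
    open import Data.List.Relation.Binary.Subset.Setoid S using (_⊆_)
    open import Data.List.Relation.Unary.Unique.Setoid S using (Unique)
    open import Data.List.Relation.Binary.Permutation.Setoid S
      using (_↭_; ↭-refl; ↭-trans; ↭-sym; ↭-prep; ↭-reflexive-≋)
    open import Data.List.Relation.Binary.Permutation.Setoid.Properties S using (shift; Unique-resp-↭; ∈-resp-↭)

    ∈-∷∧∉⇒∈ : ∀ {x z xs ys} → All (x ≉_) xs → z ∈ xs → z ∈ x ∷ ys → z ∈ ys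
    ∈-∷∧∉⇒∈ x∉xs z∈xs (here z≈x)  = contradiction (∈-resp-≈ S z≈x z∈xs) (All[≉]⇒∉ S x∉xs)
    ∈-∷∧∉⇒∈ _    _    (there z∈ys) = z∈ys

    unique-constant⇒|xs|≡1 : ∀ {z xs} → Unique xs → All (_≈ z) xs → z ∈ xs → length xs ≡ 1
    unique-constant⇒|xs|≡1 {xs = _ ∷ []}    _                  _                 _ = ≡.refl
    unique-constant⇒|xs|≡1 {xs = _ ∷ _ ∷ _} ((x≉y ∷ _) ∷ _) (x≈z ∷ y≈z ∷ _) _ =
      contradiction (trans x≈z (sym y≈z)) x≉y

    ∈⇒↭∷ : ∀ {x ys} → x ∈ ys → ∃ λ rest → ys ↭ x ∷ rest
    ∈⇒↭∷ x∈ys with as , bs , _ , x≈w , ys≋ ← ∈-∃++ S x∈ys =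
      as ++ bs , ↭-trans (↭-reflexive-≋ ys≋) (shift (sym x≈w) as bs)

    ⊆∧⊇⇒↭ : ∀ {xs ys} → Unique xs → Unique ys → xs ⊆ ys → ys ⊆ xs → xs ↭ ys
    ⊆∧⊇⇒↭ {[]}     {[]}     _ _ _ _     = ↭-refl
    ⊆∧⊇⇒↭ {[]}     {y ∷ ys} _ _ _ ys⊆[] with () ← ys⊆[] (here refl)
    ⊆∧⊇⇒↭ {x ∷ xs} {ys} (x∉xs ∷ xs!) ys! xs⊆ys ys⊆xs
      with rest , ys↭x∷rest ← ∈⇒↭∷ (xs⊆ys (here refl))
      with x∉rest ∷ rest! ← Unique-resp-↭ ys↭x∷rest ys! =
      ↭-trans (↭-prep x xs↭rest) (↭-sym ys↭x∷rest)
      where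
      xs↭rest : xs ↭ rest
      xs↭rest = ⊆∧⊇⇒↭ xs! rest!
        (λ z∈xs → ∈-∷∧∉⇒∈ x∉xs z∈xs (∈-resp-↭ ys↭x∷rest (xs⊆ys (there z∈xs))))
        (λ z∈rest → ∈-∷∧∉⇒∈ x∉rest z∈rest (ys⊆xs (∈-resp-↭ (↭-sym ys↭x∷rest) (there z∈rest))))

  module Fibres {a b ℓa ℓb} (A : Setoid a ℓa) (B : Setoid b ℓb) (_≟_ : Binary.Decidable (Setoid._≈_ B)) where
    open Setoid B using (_≈_)
    open import Data.List.Membership.Setoid B using (_∈_)
    open import Data.List.Relation.Unary.Unique.Setoid A using (Unique)
    open import Data.List.Relation.Unary.Unique.Setoid.Properties using (filter⁺)
    open import Data.Nat.Properties using (module ≤-Reasoning)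

    |xs|≤|R|*k : (f : Setoid.Carrier A → Setoid.Carrier B) (k : ℕ) →
      (∀ r ys → Unique ys → All (λ y → f y ≈ r) ys → length ys ≤ k) →
      ∀ R xs → Unique xs → All (λ x → f x ∈ R) xs → length xs ≤ length R * k
    |xs|≤|R|*k f k fibre≤k []      []      _   _        = z≤n
    |xs|≤|R|*k f k fibre≤k []      (_ ∷ _) _   (() ∷ _)
    |xs|≤|R|*k f k fibre≤k (r ∷ R) xs      xs! f[xs]⊆R = begin
      length xs                                        ≡⟨ length-filter+length-filter-∁ P? xs ⟨
      length (filter P? xs) + length (filter (∁? P?) xs)
        ≤⟨ +-mono-≤ (fibre≤k r _ (filter⁺ A P? xs!) (all-filter P? xs))
                    (|xs|≤|R|*k f k fibre≤k R _ (filter⁺ A (∁? P?) xs!) rest⊆R) ⟩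
      k + length R * k                                 ∎
      where
      open ≤-Reasoning
      P? : Decidable (λ x → f x ≈ r)
      P? x = f x ≟ r
      rest⊆R : All (λ x → f x ∈ R) (filter (∁? P?) xs)
      rest⊆R = All.zipWith (λ (fx∈r∷R , fx≉r) → Any.tail fx≉r fx∈r∷R)
        (All-filter⁺ (∁? P?) f[xs]⊆R , all-filter (∁? P?) xs)

module FieldPowers {c ℓ} (F : Field c ℓ) where
  open ListCounting using (module UniqueLists; module Fibres)
  open Arithmetic using (cofactors⇒∣)
  open import Level using (_⊔_)
  open import Data.List using (List; []; _∷_; length; map; foldr; filter; replicate)
  open import Data.List.Properties using (length-replicate)
  open import Data.List.Relation.Unary.All as All using (All; []; _∷_)
  open import Data.List.Relation.Unary.All.Properties using (all-filter)
  open import Data.List.Relation.Unary.AllPairs using ([]; _∷_)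
  import Data.Nat.Properties
  open import Data.Nat as ℕ using (ℕ; zero; suc; s≤s; z≤n; NonZero)
  open import Data.Nat.Divisibility using (_∣_; divides)
  open import Data.Nat.GCD using (gcd; gcd-GCD; gcd[m,n]≢0; module Bézout)
  open import Data.Product using (∃; _×_; _,_)
  open import Data.Sum using (inj₁)
  open import Relation.Binary.Definitions using (Decidable)
  open import Relation.Binary.PropositionalEquality as ≡ using (_≡_; _≢_)
  open import Relation.Nullary using (contradiction; Dec)
  open Field F
  open import Algebra.Properties.Semiring.Exp semiring using (^-congˡ; ^-homo-*; ^-assocʳ)
  open import Algebra.Properties.Group +-group using (x∙y⁻¹≈ε⇒x≈y)
  open import Algebra.Solver.Ring.NaturalCoefficients.Default commutativeSemiring
  open import Relation.Binary.Reasoning.Setoid setoid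
  open import Algebra.Properties.CommutativeSemigroup *-commutativeSemigroup using (interchange)
  open import Data.List.Membership.Setoid setoid using (_∈_)
  open import Data.List.Membership.Setoid.Properties using (∈-map⁺; ∈-map⁻; ∈-resp-≈; ∈-filter⁺)
  import Data.List.Relation.Unary.Unique.Setoid.Properties as Unique
  open import Data.List.Relation.Unary.Unique.Setoid setoid using (Unique)
  open import Data.List.Relation.Binary.Permutation.Setoid setoid using (_↭_)
  open import Data.List.Relation.Binary.Permutation.Setoid.Properties setoid using (foldr-commMonoid)
  open UniqueLists setoid using (⊆∧⊇⇒↭)

  -- S F q j is Powers (q ^ j + 1).
  Powers : ℕ → Carrier → Set (c ⊔ ℓ)
  Powers n y = ∃ λ x → x ≉ 0# × y ≈ x ^ᶠ n

  *-cancelˡ-≉0 : ∀ {x y z} → x ≉ 0# → x * y ≈ x * z → y ≈ z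
  *-cancelˡ-≉0 {x} {y} {z} x≉0 xy≈xz with x⁻¹ , xx⁻¹≈1 ← inverse x x≉0 =
    trans (sym (x⁻¹[x*w]≈w y)) (trans (*-congˡ xy≈xz) (x⁻¹[x*w]≈w z))
    where
    x⁻¹[x*w]≈w : ∀ w → x⁻¹ * (x * w) ≈ w
    x⁻¹[x*w]≈w w = begin
      x⁻¹ * (x * w) ≈⟨ *-assoc x⁻¹ x w ⟨
      x⁻¹ * x * w   ≈⟨ *-congʳ (trans (*-comm x⁻¹ x) xx⁻¹≈1) ⟩
      1# * w        ≈⟨ *-identityˡ w ⟩
      w             ∎

  x*y≈0⇒y≈0 : ∀ {x y} → x ≉ 0# → x * y ≈ 0# → y ≈ 0#
  x*y≈0⇒y≈0 {x} x≉0 xy≈0 = *-cancelˡ-≉0 x≉0 (trans xy≈0 (sym (zeroʳ x)))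

  *-≉0 : ∀ {x y} → x ≉ 0# → y ≉ 0# → x * y ≉ 0#
  *-≉0 x≉0 y≉0 xy≈0 = y≉0 (x*y≈0⇒y≈0 x≉0 xy≈0)

  ^-≉0 : ∀ {x} n → x ≉ 0# → x ^ᶠ n ≉ 0#
  ^-≉0 zero    _   = 1≉0
  ^-≉0 (suc n) x≉0 = *-≉0 x≉0 (^-≉0 n x≉0)

  ∣⇒Powers⊆ : ∀ {n k} → n ∣ k → ∀ y → Powers k y → Powers n y
  ∣⇒Powers⊆ {n} (divides j ≡.refl) y (x , x≉0 , y≈x^[j*n]) =
    x ^ᶠ j , ^-≉0 j x≉0 , trans y≈x^[j*n] (sym (^-assocʳ x j n))

  1^n≈1 : ∀ n → 1# ^ᶠ n ≈ 1#
  1^n≈1 zero    = refl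
  1^n≈1 (suc n) = trans (*-identityˡ _) (1^n≈1 n)

  x^n≈1⇒x^[k*n]≈1 : ∀ {x} n k → x ^ᶠ n ≈ 1# → x ^ᶠ (k ℕ.* n) ≈ 1#
  x^n≈1⇒x^[k*n]≈1 {x} n k x^n≈1 = begin
    x ^ᶠ (k ℕ.* n)  ≡⟨ ≡.cong (x ^ᶠ_) (Data.Nat.Properties.*-comm k n) ⟩
    x ^ᶠ (n ℕ.* k)  ≈⟨ ^-assocʳ x n k ⟨
    (x ^ᶠ n) ^ᶠ k   ≈⟨ ^-congˡ k x^n≈1 ⟩
    1# ^ᶠ k         ≈⟨ 1^n≈1 k ⟩
    1#              ∎

  x^m≈1∧x^n≈1⇒x^d≈1 : ∀ {x} d m n i j → d ℕ.+ j ℕ.* n ≡ i ℕ.* m →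
    x ^ᶠ m ≈ 1# → x ^ᶠ n ≈ 1# → x ^ᶠ d ≈ 1#
  x^m≈1∧x^n≈1⇒x^d≈1 {x} d m n i j d+jn≡im x^m≈1 x^n≈1 = begin
    x ^ᶠ d                    ≈⟨ *-identityʳ _ ⟨
    x ^ᶠ d * 1#               ≈⟨ *-congˡ (x^n≈1⇒x^[k*n]≈1 n j x^n≈1) ⟨
    x ^ᶠ d * x ^ᶠ (j ℕ.* n)   ≈⟨ ^-homo-* x d (j ℕ.* n) ⟨
    x ^ᶠ (d ℕ.+ j ℕ.* n)      ≡⟨ ≡.cong (x ^ᶠ_) d+jn≡im ⟩
    x ^ᶠ (i ℕ.* m)            ≈⟨ x^n≈1⇒x^[k*n]≈1 m i x^m≈1 ⟩
    1#                        ∎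

  x^a≈1∧x^b≈1⇒x^gcd≈1 : ∀ {x} a b → x ^ᶠ a ≈ 1# → x ^ᶠ b ≈ 1# → x ^ᶠ gcd a b ≈ 1#
  x^a≈1∧x^b≈1⇒x^gcd≈1 a b x^a≈1 x^b≈1 with Bézout.identity (gcd-GCD a b)
  ... | Bézout.+- i j eq = x^m≈1∧x^n≈1⇒x^d≈1 _ a b i j eq x^a≈1 x^b≈1
  ... | Bézout.-+ i j eq = x^m≈1∧x^n≈1⇒x^d≈1 _ b a j i eq x^b≈1 x^a≈1

  -- A monic polynomial of degree length cs; cs lists the lower coefficients, constant term first.
  evalMonic : List Carrier → Carrier → Carrier
  evalMonic []       x = 1#
  evalMonic (a ∷ cs) x = a + x * evalMonic cs x

  x-r+r≈x : ∀ x r → x - r + r ≈ x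
  x-r+r≈x x r = begin
    x - r + r    ≈⟨ +-assoc x (- r) r ⟩
    x + (- r + r) ≈⟨ +-congˡ (-‿inverseˡ r) ⟩
    x + 0#       ≈⟨ +-identityʳ x ⟩
    x            ∎

  divide-by-x-r : ∀ r a cs → ∃ λ ds → length ds ≡ length cs ×
    (∀ x → evalMonic (a ∷ cs) x ≈ (x - r) * evalMonic ds x + evalMonic (a ∷ cs) r)
  divide-by-x-r r a [] = [] , ≡.refl , λ x → begin
    a + x * 1#                   ≈⟨ +-congˡ (*-congʳ (x-r+r≈x x r)) ⟨
    a + (x - r + r) * 1#         ≈⟨ identity a (x - r) r ⟩
    (x - r) * 1# + (a + r * 1#)  ∎
    where
    identity : ∀ a y r → a + (y + r) * 1# ≈ y * 1# + (a + r * 1#)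
    identity = solve 3 (λ a y r → a :+ (y :+ r) :* con 1 := y :* con 1 :+ (a :+ r :* con 1)) refl
  divide-by-x-r r a (c ∷ cs) with ds , |ds|≡|cs| , division ← divide-by-x-r r c cs =
    C ∷ ds , ≡.cong suc |ds|≡|cs| , λ x → begin
      a + x * P x                                ≈⟨ +-congˡ (*-cong (sym (x-r+r≈x x r)) (division x)) ⟩
      a + (x - r + r) * ((x - r) * Q x + C)      ≈⟨ identity a (x - r) r (Q x) C ⟩
      (x - r) * (C + (x - r + r) * Q x) + (a + r * C) ≈⟨ +-congʳ (*-congˡ (+-congˡ (*-congʳ (x-r+r≈x x r)))) ⟩
      (x - r) * (C + x * Q x) + (a + r * C)      ∎
    where
    P = evalMonic (c ∷ cs)
    Q = evalMonic ds
    C = P r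
    identity : ∀ a y r Q C → a + (y + r) * (y * Q + C) ≈ y * (C + (y + r) * Q) + (a + r * C)
    identity = solve 5 (λ a y r Q C → a :+ (y :+ r) :* (y :* Q :+ C) := y :* (C :+ (y :+ r) :* Q) :+ (a :+ r :* C)) refl

  roots⇒|rs|≤degree : ∀ cs rs → Unique rs → All (λ r → evalMonic cs r ≈ 0#) rs → length rs ℕ.≤ length cs
  roots⇒|rs|≤degree cs       []       _             _                 = z≤n
  roots⇒|rs|≤degree []       (r ∷ _)  _             (1≈0 ∷ _)         = contradiction 1≈0 1≉0
  roots⇒|rs|≤degree (a ∷ cs) (r ∷ rs) (r∉rs ∷ rs!) (p[r]≈0 ∷ p[rs]≈0)
    with ds , |ds|≡|cs| , division ← divide-by-x-r r a cs =
    s≤s (≡.subst (length rs ℕ.≤_) |ds|≡|cs|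
      (roots⇒|rs|≤degree ds rs rs! (All.zipWith (λ (r≉s , p[s]≈0) → quotient-root r≉s p[s]≈0) (r∉rs , p[rs]≈0))))
    where
    quotient-root : ∀ {s} → r ≉ s → evalMonic (a ∷ cs) s ≈ 0# → evalMonic ds s ≈ 0#
    quotient-root {s} r≉s p[s]≈0 = x*y≈0⇒y≈0 (λ s-r≈0 → r≉s (sym (x∙y⁻¹≈ε⇒x≈y s r s-r≈0))) (begin
      (s - r) * evalMonic ds s                              ≈⟨ +-identityʳ _ ⟨
      (s - r) * evalMonic ds s + 0#                         ≈⟨ +-congˡ p[r]≈0 ⟨
      (s - r) * evalMonic ds s + evalMonic (a ∷ cs) r       ≈⟨ division s ⟨
      evalMonic (a ∷ cs) s                                  ≈⟨ p[s]≈0 ⟩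
      0#                                                    ∎)

  evalMonic-zeros : ∀ n x → evalMonic (replicate n 0#) x ≈ x ^ᶠ n
  evalMonic-zeros zero    x = refl
  evalMonic-zeros (suc n) x = trans (+-identityˡ _) (*-congˡ (evalMonic-zeros n x))

  roots[x^n≈k]⇒|rs|≤n : ∀ n .{{_ : NonZero n}} k rs → Unique rs → All (λ r → r ^ᶠ n ≈ k) rs → length rs ℕ.≤ n
  roots[x^n≈k]⇒|rs|≤n (suc n) k rs rs! r^n≈k = ≡.subst (length rs ℕ.≤_) (≡.cong suc (length-replicate n))
    (roots⇒|rs|≤degree (- k ∷ replicate n 0#) rs rs! (All.map root r^n≈k))
    where
    root : ∀ {r} → r ^ᶠ suc n ≈ k → - k + r * evalMonic (replicate n 0#) r ≈ 0#
    root {r} r^[1+n]≈k = begin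
      - k + r * evalMonic (replicate n 0#) r ≈⟨ +-congˡ (*-congˡ (evalMonic-zeros n r)) ⟩
      - k + r ^ᶠ suc n                       ≈⟨ +-congˡ r^[1+n]≈k ⟩
      - k + k                                ≈⟨ -‿inverseˡ k ⟩
      0#                                     ∎

  product : List Carrier → Carrier
  product = foldr _*_ 1#

  product-map-*ˡ : ∀ y xs → product (map (y *_) xs) ≈ y ^ᶠ length xs * product xs
  product-map-*ˡ y []       = sym (*-identityˡ 1#)
  product-map-*ˡ y (x ∷ xs) = begin
    y * x * product (map (y *_) xs)               ≈⟨ *-congˡ (product-map-*ˡ y xs) ⟩
    y * x * (y ^ᶠ length xs * product xs)         ≈⟨ interchange y x (y ^ᶠ length xs) (product xs) ⟩
    y * y ^ᶠ length xs * (x * product xs)         ∎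

  product-≉0 : ∀ {xs} → All (_≉ 0#) xs → product xs ≉ 0#
  product-≉0 []           = 1≉0
  product-≉0 (x≉0 ∷ xs≉0) = *-≉0 x≉0 (product-≉0 xs≉0)

  module Units (units : List Carrier) (units! : Unique units) (units≉0 : All (_≉ 0#) units)
               (∈units : ∀ {x} → x ≉ 0# → x ∈ units) where

    ∈units⇒≉0 : ∀ {x} → x ∈ units → x ≉ 0#
    ∈units⇒≉0 = All.lookupₛ setoid (λ x≈y x≉0 y≈0 → x≉0 (trans x≈y y≈0)) units≉0

    x^|units|≈1 : ∀ {x} → x ≉ 0# → x ^ᶠ length units ≈ 1#
    x^|units|≈1 {x} x≉0 with x⁻¹ , xx⁻¹≈1 ← inverse x x≉0 = *-cancelˡ-≉0 (product-≉0 units≉0) (begin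
      product units * x ^ᶠ length units  ≈⟨ *-comm _ _ ⟩
      x ^ᶠ length units * product units  ≈⟨ product-map-*ˡ x units ⟨
      product (map (x *_) units)         ≈⟨ foldr-commMonoid *-isCommutativeMonoid x*units↭units ⟩
      product units                      ≈⟨ *-identityʳ _ ⟨
      product units * 1#                 ∎)
      where
      x*units↭units : map (x *_) units ↭ units
      x*units↭units = ⊆∧⊇⇒↭ (Unique.map⁺ setoid setoid (*-cancelˡ-≉0 x≉0) units!) units! x*units⊆units units⊆x*units
        where
        x*units⊆units : ∀ {z} → z ∈ map (x *_) units → z ∈ units
        x*units⊆units z∈ with w , w∈units , z≈xw ← ∈-map⁻ setoid setoid z∈ =
          ∈units (λ z≈0 → *-≉0 x≉0 (∈units⇒≉0 w∈units) (trans (sym z≈xw) z≈0))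
        units⊆x*units : ∀ {z} → z ∈ units → z ∈ map (x *_) units
        units⊆x*units {z} z∈units = ∈-resp-≈ setoid x[x⁻¹z]≈z
          (∈-map⁺ setoid setoid *-congˡ (∈units (*-≉0 x⁻¹≉0 (∈units⇒≉0 z∈units))))
          where
          x⁻¹≉0 : x⁻¹ ≉ 0#
          x⁻¹≉0 x⁻¹≈0 = 1≉0 (trans (sym xx⁻¹≈1) (trans (*-congˡ x⁻¹≈0) (zeroʳ x)))
          x[x⁻¹z]≈z : x * (x⁻¹ * z) ≈ z
          x[x⁻¹z]≈z = trans (sym (*-assoc x x⁻¹ z)) (trans (*-congʳ xx⁻¹≈1) (*-identityˡ z))

    |units|≢0 : NonZero (length units)
    |units|≢0 = nonempty (∈units 1≉0)
      where
      nonempty : ∀ {xs} → 1# ∈ xs → NonZero (length xs)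
      nonempty {_ ∷ _} _ = _

    [x^m]^j≈1 : ∀ {x} m j → x ≉ 0# → length units ≡ j ℕ.* m → (x ^ᶠ m) ^ᶠ j ≈ 1#
    [x^m]^j≈1 {x} m j x≉0 N≡j*m = begin
      (x ^ᶠ m) ^ᶠ j    ≈⟨ ^-assocʳ x m j ⟩
      x ^ᶠ (m ℕ.* j)   ≡⟨ ≡.cong (x ^ᶠ_) (≡.trans (Data.Nat.Properties.*-comm m j) (≡.sym N≡j*m)) ⟩
      x ^ᶠ length units ≈⟨ x^|units|≈1 x≉0 ⟩
      1#               ∎

    module _ (_≟_ : Decidable _≈_) where
      open Fibres setoid setoid _≟_ using (|xs|≤|R|*k)

      Powers⊆⇒∣ : ∀ {n k} .{{_ : NonZero k}} → n ∣ length units → k ∣ length units →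
        (∀ y → Powers k y → Powers n y) → n ∣ k
      Powers⊆⇒∣ {n} {k} (divides a N≡a*n) (divides b N≡b*k) Pₖ⊆Pₙ =
        cofactors⇒∣ {a = a} {b = b} {{|units|≢0}} N≡a*n N≡b*k (Data.Nat.Properties.≤-trans
          (|xs|≤|R|*k (_^ᶠ k) k fibre≤k roots units units! (All.map x^k∈roots units≉0))
          (Data.Nat.Properties.*-monoˡ-≤ k |roots|≤g))
        where
        g = gcd a b
        instance
          g≢0 : NonZero g
          g≢0 = ℕ.≢-nonZero (gcd[m,n]≢0 a b (inj₁ a≢0))
            where
            a≢0 : a ≢ 0
            a≢0 ≡.refl = ℕ.≢-nonZero⁻¹ (length units) {{|units|≢0}} N≡a*n
        root? : ∀ r → Dec (r ^ᶠ g ≈ 1#)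
        root? r = (r ^ᶠ g) ≟ 1#
        roots = filter root? units
        |roots|≤g : length roots ℕ.≤ g
        |roots|≤g = roots[x^n≈k]⇒|rs|≤n g 1# roots (Unique.filter⁺ setoid root? units!) (all-filter root? units)
        x^k∈roots : ∀ {x} → x ≉ 0# → x ^ᶠ k ∈ roots
        x^k∈roots {x} x≉0 with w , w≉0 , x^k≈w^n ← Pₖ⊆Pₙ (x ^ᶠ k) (x , x≉0 , refl) =
          ∈-filter⁺ setoid root? (λ r≈s r^g≈1 → trans (^-congˡ g (sym r≈s)) r^g≈1)
            (∈units (^-≉0 k x≉0))
            (x^a≈1∧x^b≈1⇒x^gcd≈1 a b
              (trans (^-congˡ a x^k≈w^n) ([x^m]^j≈1 n a w≉0 N≡a*n))
              ([x^m]^j≈1 k b x≉0 N≡b*k))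
        fibre≤k : ∀ r ys → Unique ys → All (λ y → y ^ᶠ k ≈ r) ys → length ys ℕ.≤ k
        fibre≤k = roots[x^n≈k]⇒|rs|≤n k

module FiniteField {c ℓ} (F : Field c ℓ) {N} (size : HasSize F N) where
  open ListCounting using (length-filter+length-filter-∁; module UniqueLists)
  open FieldPowers F using (module Units)
  open import Data.Fin using (Fin)
  import Data.Fin.Properties as Fin
  open import Data.List using (List; length; filter; tabulate)
  open import Data.List.Properties using (length-tabulate)
  open import Data.List.Relation.Unary.All.Properties using (all-filter)
  open import Data.Nat as ℕ using (_∸_)
  open import Data.Nat.Properties using (m+n∸m≡n)
  open import Data.Product using (proj₁; proj₂)
  open import Relation.Binary.Definitions using (Decidable)
  open import Relation.Binary.PropositionalEquality as ≡ using (_≡_)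
  open import Relation.Nullary.Decidable using (map′)
  open import Relation.Unary.Properties using (∁?)
  open Field F
  open import Data.List.Membership.Setoid setoid using (_∈_)
  open import Data.List.Membership.Setoid.Properties using (∈-resp-≈; ∈-tabulate⁺; ∈-filter⁺)
  open import Data.List.Relation.Unary.Unique.Setoid setoid using (Unique)
  import Data.List.Relation.Unary.Unique.Setoid.Properties as Unique
  open UniqueLists setoid using (unique-constant⇒|xs|≡1)

  private
    enum : Fin N → Carrier
    enum = proj₁ size
    index : Carrier → Fin N
    index x = proj₁ (proj₂ (proj₂ size) x)
    enum-index : ∀ x → enum (index x) ≈ x
    enum-index x = proj₂ (proj₂ (proj₂ size) x)
    enum-injective : ∀ {i j} → enum i ≈ enum j → i ≡ j
    enum-injective = proj₁ (proj₂ size) _ _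

  _≟_ : Decidable _≈_
  x ≟ y = map′
    (λ i≡j → trans (sym (enum-index x)) (trans (reflexive (≡.cong enum i≡j)) (enum-index y)))
    (λ x≈y → enum-injective (trans (enum-index x) (trans x≈y (sym (enum-index y)))))
    (index x Fin.≟ index y)

  elements : List Carrier
  elements = tabulate enum

  elements! : Unique elements
  elements! = Unique.tabulate⁺ setoid enum-injective

  ∈elements : ∀ x → x ∈ elements
  ∈elements x = ∈-resp-≈ setoid (enum-index x) (∈-tabulate⁺ setoid (index x))

  units : List Carrier
  units = filter (∁? (_≟ 0#)) elements

  |units|≡N∸1 : length units ≡ N ∸ 1
  |units|≡N∸1 = ≡.trans (≡.sym (m+n∸m≡n 1 (length units))) (≡.cong (_∸ 1) (begin
    1 ℕ.+ length units                                  ≡⟨ ≡.cong (ℕ._+ length units) |zeros|≡1 ⟨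
    length zeros ℕ.+ length units                       ≡⟨ length-filter+length-filter-∁ (_≟ 0#) elements ⟩
    length elements                                     ≡⟨ length-tabulate enum ⟩
    N                                                   ∎))
    where
    open ≡.≡-Reasoning
    zeros = filter (_≟ 0#) elements
    |zeros|≡1 : length zeros ≡ 1
    |zeros|≡1 = unique-constant⇒|xs|≡1
      (Unique.filter⁺ setoid (_≟ 0#) elements!)
      (all-filter (_≟ 0#) elements)
      (∈-filter⁺ setoid (_≟ 0#) (λ x≈y x≈0 → trans (sym x≈y) x≈0) (∈elements 0#) refl)

  units! : Unique units
  units! = Unique.filter⁺ setoid (∁? (_≟ 0#)) elements!

  ∈units : ∀ {x} → x ≉ 0# → x ∈ units
  ∈units {x} = ∈-filter⁺ setoid (∁? (_≟ 0#)) (λ x≈y x≉0 y≈0 → x≉0 (trans x≈y y≈0)) (∈elements x)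

  open Units units units! (all-filter (∁? (_≟ 0#)) elements) ∈units public

open Arithmetic using (n+1≢0; q^ℓ+1∣q^m∸1; q^ℓ+1∣q^L+1⇔ℓ∣L∧odd)
open import Level using (Level)
open import Data.Nat using (ℕ; _+_; _^_; _/_; NonZero; _<_; _≤_; nonTrivial⇒n>1; nonTrivial⇒nonZero)
open import Data.Nat.Divisibility using (_∣_)
open import Data.Nat.Primality using (prime⇒nonTrivial)
open import Data.Nat.Properties using (<-≤-trans; ^-monoʳ-≤; ^-identityʳ)
open import Data.List using (length)
open import Data.Product using (_×_; _,_)
open import Relation.Nullary using (¬_)
open import Function.Bundles using (_⇔_; mk⇔)
open import Relation.Binary.PropositionalEquality using (refl; subst; sym)

prime-power⇒>1 : ∀ {q} → IsPrimePower q → 1 < q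
prime-power⇒>1 (p , k , p-prime , 1≤k , refl) = <-≤-trans p>1
  (subst (_≤ p ^ k) (^-identityʳ p) (^-monoʳ-≤ p 1≤k))
  where
  instance
    p-nonTrivial = prime⇒nonTrivial p-prime
    p-nonZero = nonTrivial⇒nonZero p
  p>1 = nonTrivial⇒n>1 p

lemma2p7 : ∀ {c ℓ' : Level} (q ℓ L m : ℕ) → IsPrimePower q →
    .{{_ : NonZero ℓ}} → .{{_ : NonZero L}} → .{{_ : NonZero m}} →
    ℓ ∣ m → L ∣ m → 2 ∣ (m / ℓ) → 2 ∣ (m / L) →
    (F : Field c ℓ') → HasSize F (q ^ m) →
    ((∀ y → S F q L y → S F q ℓ y) ⇔ (q ^ ℓ + 1 ∣ q ^ L + 1))
    × ((q ^ ℓ + 1 ∣ q ^ L + 1) ⇔ (ℓ ∣ L × ¬ (2 ∣ (L / ℓ))))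
lemma2p7 q ℓ L m q-prime-power ℓ∣m L∣m 2∣m/ℓ 2∣m/L F size =
  mk⇔ (Powers⊆⇒∣ _≟_ {{n+1≢0 (q ^ L)}} (q^j+1∣|units| ℓ ℓ∣m 2∣m/ℓ) (q^j+1∣|units| L L∣m 2∣m/L))
      ∣⇒Powers⊆ ,
  q^ℓ+1∣q^L+1⇔ℓ∣L∧odd q ℓ L (prime-power⇒>1 q-prime-power)
  where
  open FiniteField F size
  open FieldPowers F using (∣⇒Powers⊆)
  q^j+1∣|units| : ∀ j .{{_ : NonZero j}} → j ∣ m → 2 ∣ m / j → q ^ j + 1 ∣ length units
  q^j+1∣|units| j j∣m 2∣m/j = subst (q ^ j + 1 ∣_) (sym |units|≡N∸1) (q^ℓ+1∣q^m∸1 q j m j∣m 2∣m/j)
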